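{- Let $f:\mathbb{N}\to\mathbb{R}$ be a nonnegative multiplicative function with $f(1)=1$, and let $k\ge2$ be a fixed integer. If for every prime $p$ and all integers $a,b\ge0$ one has $\big(f(p^{a+b})\big)^k\le f(p^{ka})f(p^{kb})$ (resp. $\big(f(p^{a+b})\big)^k\ge f(p^{ka})f(p^{kb})$), then $f$ is $k$-sub-multiplicative (resp. $k$-super-multiplicative).
   Context: $\mathbb{N}=\{1,2,3,\dots\}$. $f$ is multiplicative if $f(mn)=f(m)f(n)$ whenever $\gcd(m,n)=1$. $f$ is $k$-sub-multiplicative if $\big(f(mn)\big)^k\le f(m^k)f(n^k)$ for all $m,n\ge1$, and $k$-super-multiplicative if $\big(f(mn)\big)^k\ge f(m^k)f(n^k)$ for all $m,n\ge1$. -}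

module Defs where

open import Level using (Level; _⊔_; suc)
open import Data.Nat as ℕ using (ℕ; NonZero)
open import Data.Nat.Coprimality using (Coprime)
open import Data.Nat.Primality using (Prime)
open import Relation.Binary.Core using (Rel)
open import Relation.Binary.Structures using (IsTotalOrder)
open import Algebra.Bundles using (CommutativeRing)
import Algebra.Bundles
import Algebra.Definitions.RawSemiring as RS

-- The real numbers ℝ are an instance.
record OrderedCommutativeRing (c ℓ₁ ℓ₂ : Level) : Set (suc (c ⊔ ℓ₁ ⊔ ℓ₂)) where
  field
    commutativeRing : CommutativeRing c ℓ₁
  open CommutativeRing commutativeRing public
  field
    _≤_          : Rel Carrier ℓ₂
    isTotalOrder : IsTotalOrder _≈_ _≤_
    +-monoˡ-≤    : ∀ {a b} c → a ≤ b → (a + c) ≤ (b + c)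
    0≤*          : ∀ {a b} → 0# ≤ a → 0# ≤ b → 0# ≤ (a * b)
  open RS (Algebra.Bundles.Semiring.rawSemiring semiring) public using (_^_)

module _ {c ℓ₁ ℓ₂} (R : OrderedCommutativeRing c ℓ₁ ℓ₂) where
  open OrderedCommutativeRing R

  -- f : ℕ → R is considered on ℕ⁺ = {1,2,3,...}; f 0 is irrelevant.
  Nonnegative : (ℕ → Carrier) → Set ℓ₂
  Nonnegative f = ∀ n → .{{NonZero n}} → 0# ≤ f n

  Multiplicative : (ℕ → Carrier) → Set ℓ₁
  Multiplicative f = ∀ m n → .{{NonZero m}} → .{{NonZero n}} →
    Coprime m n → f (m ℕ.* n) ≈ (f m * f n)

  SubMultiplicative : ℕ → (ℕ → Carrier) → Set ℓ₂
  SubMultiplicative k f = ∀ m n → .{{NonZero m}} → .{{NonZero n}} →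
    (f (m ℕ.* n) ^ k) ≤ (f (m ℕ.^ k) * f (n ℕ.^ k))

  SuperMultiplicative : ℕ → (ℕ → Carrier) → Set ℓ₂
  SuperMultiplicative k f = ∀ m n → .{{NonZero m}} → .{{NonZero n}} →
    (f (m ℕ.* n) ^ k) ≥ (f (m ℕ.^ k) * f (n ℕ.^ k))
    where _≥_ = λ x y → y ≤ x

  PrimeSubCondition : ℕ → (ℕ → Carrier) → Set ℓ₂
  PrimeSubCondition k f = ∀ p → Prime p → ∀ a b →
    (f (p ℕ.^ (a ℕ.+ b)) ^ k) ≤ (f (p ℕ.^ (k ℕ.* a)) * f (p ℕ.^ (k ℕ.* b)))

  PrimeSuperCondition : ℕ → (ℕ → Carrier) → Set ℓ₂
  PrimeSuperCondition k f = ∀ p → Prime p → ∀ a b →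
    (f (p ℕ.^ (k ℕ.* a)) * f (p ℕ.^ (k ℕ.* b))) ≤ (f (p ℕ.^ (a ℕ.+ b)) ^ k)

{-# OPTIONS --safe #-}
module Submission where

-- Write m = pᵃm′ and n = pᵇn′ with p ∤ m′n′. By multiplicativity both sides of
-- f(mn)ᵏ ≤ f(mᵏ)f(nᵏ) split into a p-part, which is the prime-power hypothesis
-- f(pᵃ⁺ᵇ)ᵏ ≤ f(pᵏᵃ)f(pᵏᵇ), and a part coprime to p, which is the same inequality
-- for (m′, n′). All factors being nonnegative, the two inequalities multiply, and
-- induction on m + n concludes. The reversed inequality is the same argument for
-- the opposite order.

open import Defs
import Data.Nat as ℕ
open import Data.Nat using (ℕ; NonZero)
open import Data.Nat.Coprimality using (Coprime)
open import Data.Nat.Divisibility using (_∤_)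
open import Data.Nat.Primality using (Prime; prime[2])
open import Data.Product using (_×_; _,_)
open import Function using (flip)
open import Relation.Binary.Core using (Rel)
open import Relation.Binary.Structures using (IsPreorder; IsTotalOrder)
import Relation.Binary.Construct.Flip.EqAndOrd as Flip

module _ where
  open import Data.Nat
  open import Data.Nat.Properties
  open import Data.Nat.Divisibility
  import Data.Nat.Coprimality as Coprime
  open import Data.Nat.Primality
  open import Data.Nat.Primality.Factorisation using (factorise)
  open import Data.Nat.Induction using (<-rec)
  open import Data.List using ([]; _∷_)
  open import Data.Nat.ListAction using (product)
  open import Data.List.Relation.Unary.All using (_∷_)
  open import Data.Product using (∃-syntax)
  open import Data.Sum using (_⊎_; inj₁; inj₂)
  open import Relation.Nullary using (yes; no; contradiction)
  open import Relation.Binary.PropositionalEquality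

  open import Algebra.Properties.CommutativeSemigroup *-commutativeSemigroup
    using (interchange)

  private variable i j m n o p : ℕ

  ^-distribʳ-* : ∀ m n k → (m * n) ^ k ≡ m ^ k * n ^ k
  ^-distribʳ-* m n zero    = refl
  ^-distribʳ-* m n (suc k) = begin
    m * n * (m * n) ^ k       ≡⟨ cong (m * n *_) (^-distribʳ-* m n k) ⟩
    m * n * (m ^ k * n ^ k)   ≡⟨ interchange m n (m ^ k) (n ^ k) ⟩
    m * m ^ k * (n * n ^ k)   ∎
    where open ≡-Reasoning

  coprime-∣ : i ∣ m → j ∣ n → Coprime m n → Coprime i j
  coprime-∣ i∣m j∣n c (d∣i , d∣j) = c (∣-trans d∣i i∣m , ∣-trans d∣j j∣n)

  coprime-*ʳ : Coprime m n → Coprime m o → Coprime m (n * o)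
  coprime-*ʳ c₁ c₂ (d∣m , d∣n*o) =
    c₂ (d∣m , Coprime.coprime-divisor (coprime-∣ d∣m ∣-refl c₁) d∣n*o)

  coprime-*ˡ : Coprime m o → Coprime n o → Coprime (m * n) o
  coprime-*ˡ c₁ c₂ = Coprime.sym (coprime-*ʳ (Coprime.sym c₁) (Coprime.sym c₂))

  coprime-^ʳ : ∀ k → Coprime m n → Coprime m (n ^ k)
  coprime-^ʳ zero    _ (_ , d∣1) = ∣1⇒≡1 d∣1
  coprime-^ʳ (suc k) c = coprime-*ʳ c (coprime-^ʳ k c)

  coprime-^ˡ : ∀ k → Coprime m n → Coprime (m ^ k) n
  coprime-^ˡ k c = Coprime.sym (coprime-^ʳ k (Coprime.sym c))

  coprime-^ : ∀ k l → Coprime m n → Coprime (m ^ k) (n ^ l)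
  coprime-^ k l c = coprime-^ˡ k (coprime-^ʳ l c)

  prime∧∤⇒coprime : Prime p → p ∤ n → Coprime p n
  prime∧∤⇒coprime pp p∤n (d∣p , d∣n) with prime⇒irreducible pp d∣p
  ... | inj₁ d≡1 = d≡1
  ... | inj₂ refl = contradiction d∣n p∤n

  ∤⇒nonZero : m ∤ n → NonZero n
  ∤⇒nonZero {m} {zero}  m∤0 = contradiction (m ∣0) m∤0
  ∤⇒nonZero {n = suc _} _   = _

  ≡1⊎∃prime∣ : ∀ n → .{{NonZero n}} → n ≡ 1 ⊎ ∃[ p ] Prime p × p ∣ n
  ≡1⊎∃prime∣ n with factorise n
  ... | record { factors = [] ; isFactorisation = n≡1 } = inj₁ n≡1
  ... | record { factors = p ∷ ps ; isFactorisation = n≡p*ps ; factorsPrime = pp ∷ _ } =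
    inj₂ (p , pp , divides (product ps) (trans n≡p*ps (*-comm p (product ps))))

  record PrimePowerSplit (p n : ℕ) : Set where
    field
      exponent cofactor : ℕ
      n≡p^e*c           : n ≡ p ^ exponent * cofactor
      p∤c               : p ∤ cofactor

  splitPrimePower : Prime p → ∀ n → .{{NonZero n}} → PrimePowerSplit p n
  splitPrimePower {p} pp = <-rec _ split
    where
    split : ∀ n → (∀ {m} → m < n → .{{NonZero m}} → PrimePowerSplit p m) →
            .{{NonZero n}} → PrimePowerSplit p n
    split n rec with p ∣? n
    ... | no p∤n = record
      { exponent = 0 ; cofactor = n ; n≡p^e*c = sym (+-identityʳ n) ; p∤c = p∤n }
    ... | yes p∣n = record
      { exponent = suc e ; cofactor = c ; p∤c = p∤c
      ; n≡p^e*c = begin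
          n               ≡⟨ m∣n⇒n≡m*quotient p∣n ⟩
          p * quotient p∣n ≡⟨ cong (p *_) q≡p^e*c ⟩
          p * (p ^ e * c) ≡⟨ *-assoc p (p ^ e) c ⟨
          p ^ suc e * c   ∎
      }
      where
      open ≡-Reasoning
      instance
        _ = prime⇒nonTrivial pp
        _ = quotient≢0 p∣n
      open PrimePowerSplit (rec (quotient-< p∣n))
        renaming (exponent to e; cofactor to c; n≡p^e*c to q≡p^e*c)

  cofactor-< : .{{NonZero n}} → n ≡ m * o → p ∣ n → p ∤ o → o < n
  cofactor-< {m = m} n≡m*o p∣n p∤o =
    ≤∧≢⇒< (∣⇒≤ (divides m n≡m*o)) λ { refl → p∤o p∣n }

  module _ {ℓ} (P : ℕ → ℕ → Set ℓ) (P[1,1] : P 1 1)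
    (P-step : ∀ p a b m n → Prime p → p ∤ m → p ∤ n → P m n → P (p ^ a * m) (p ^ b * n))
    where

    pairInduction : ∀ m n → .{{NonZero m}} → .{{NonZero n}} → P m n
    pairInduction m n = <-rec Q step (m + n) m n refl
      where
      Q : ℕ → Set ℓ
      Q s = ∀ m n → .{{NonZero m}} → .{{NonZero n}} → m + n ≡ s → P m n

      step : ∀ s → (∀ {t} → t < s → Q t) → Q s
      step _ rec m n refl with ≡1⊎∃prime∣ (m * n) {{m*n≢0 m n}}
      ... | inj₁ m*n≡1 =
        subst₂ P (sym (m*n≡1⇒m≡1 m n m*n≡1)) (sym (m*n≡1⇒n≡1 m n m*n≡1)) P[1,1]
      ... | inj₂ (p , pp , p∣m*n) =
        subst₂ P (sym m≡) (sym n≡) (P-step p a b m′ n′ pp p∤m′ p∤n′ (rec smaller m′ n′ refl))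
        where
        open PrimePowerSplit (splitPrimePower pp m)
          renaming (exponent to a; cofactor to m′; n≡p^e*c to m≡; p∤c to p∤m′)
        open PrimePowerSplit (splitPrimePower pp n)
          renaming (exponent to b; cofactor to n′; n≡p^e*c to n≡; p∤c to p∤n′)
        instance
          _ = ∤⇒nonZero p∤m′
          _ = ∤⇒nonZero p∤n′
        smaller : m′ + n′ < m + n
        smaller with euclidsLemma m n pp p∣m*n
        ... | inj₁ p∣m = +-mono-<-≤ (cofactor-< {m = p ^ a} m≡ p∣m p∤m′) (∣⇒≤ (divides (p ^ b) n≡))
        ... | inj₂ p∣n = +-mono-≤-< (∣⇒≤ (divides (p ^ a) m≡)) (cofactor-< {m = p ^ b} n≡ p∣n p∤n′)

module OrderedCommutativeRingProperties {c ℓ₁ ℓ₂} (R : OrderedCommutativeRing c ℓ₁ ℓ₂) where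
  open OrderedCommutativeRing R
  open IsTotalOrder isTotalOrder using (total; ≤-respˡ-≈; ≤-respʳ-≈) renaming (trans to ≤-trans)
  open import Algebra.Properties.Ring ring using (-1*x≈-x; [y-z]x≈yx-zx)
  open import Algebra.Properties.Group +-group using (⁻¹-involutive)
  open import Data.Sum using (inj₁; inj₂)
  open import Relation.Binary.Reasoning.Setoid setoid

  x≤y⇒0≤y-x : ∀ {x y} → x ≤ y → 0# ≤ (y - x)
  x≤y⇒0≤y-x {x} x≤y = ≤-respˡ-≈ (-‿inverseʳ x) (+-monoˡ-≤ (- x) x≤y)

  0≤1# : 0# ≤ 1#
  0≤1# with total 0# 1#
  ... | inj₁ 0≤1 = 0≤1
  ... | inj₂ 1≤0 = ≤-respʳ-≈ (-1*-1≈1) (0≤* 0≤-1 0≤-1)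
    where
    0≤-1 : 0# ≤ (- 1#)
    0≤-1 = ≤-respʳ-≈ (+-identityˡ (- 1#)) (x≤y⇒0≤y-x 1≤0)
    -1*-1≈1 : - 1# * - 1# ≈ 1#
    -1*-1≈1 = trans (-1*x≈-x (- 1#)) (⁻¹-involutive 1#)

  x^n-nonNeg : ∀ {x} → 0# ≤ x → ∀ n → 0# ≤ (x ^ n)
  x^n-nonNeg _   ℕ.zero    = 0≤1#
  x^n-nonNeg 0≤x (ℕ.suc n) = 0≤* 0≤x (x^n-nonNeg 0≤x n)

  *-monoˡ-≤-nonNeg : ∀ {a b c} → 0# ≤ c → a ≤ b → (a * c) ≤ (b * c)
  *-monoˡ-≤-nonNeg {a} {b} {c} 0≤c a≤b =
    ≤-respˡ-≈ (+-identityˡ (a * c)) (≤-respʳ-≈ [b-a]c+ac≈bc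
      (+-monoˡ-≤ (a * c) (0≤* (x≤y⇒0≤y-x a≤b) 0≤c)))
    where
    [b-a]c+ac≈bc : (b - a) * c + a * c ≈ b * c
    [b-a]c+ac≈bc = begin
      (b - a) * c + a * c         ≈⟨ +-congʳ ([y-z]x≈yx-zx c b a) ⟩
      (b * c - a * c) + a * c     ≈⟨ +-assoc (b * c) (- (a * c)) (a * c) ⟩
      b * c + (- (a * c) + a * c) ≈⟨ +-congˡ (-‿inverseˡ (a * c)) ⟩
      b * c + 0#                  ≈⟨ +-identityʳ (b * c) ⟩
      b * c                       ∎

  *-mono-≤-nonNeg : ∀ {a b c d} → 0# ≤ b → 0# ≤ c → a ≤ b → c ≤ d → (a * c) ≤ (b * d)
  *-mono-≤-nonNeg {b = b} {c} {d} 0≤b 0≤c a≤b c≤d = ≤-trans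
    (*-monoˡ-≤-nonNeg 0≤c a≤b)
    (≤-respˡ-≈ (*-comm c b) (≤-respʳ-≈ (*-comm d b) (*-monoˡ-≤-nonNeg 0≤b c≤d)))

module _ {c ℓ₁ ℓ₂} (R : OrderedCommutativeRing c ℓ₁ ℓ₂) where
  open OrderedCommutativeRing R

  module PrimePowerTransfer
    (_∼_ : Rel Carrier ℓ₂) (∼-isPreorder : IsPreorder _≈_ _∼_)
    (∼-*-nonNeg : ∀ {x y u v} → 0# ≤ x → 0# ≤ y → 0# ≤ u → 0# ≤ v →
                  x ∼ y → u ∼ v → (x * u) ∼ (y * v))
    (f : ℕ → Carrier) (f-nonNeg : Nonnegative R f) (f-mult : Multiplicative R f) (k : ℕ)
    (prime-condition : ∀ p → Prime p → ∀ a b →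
      (f (p ℕ.^ (a ℕ.+ b)) ^ k) ∼ (f (p ℕ.^ (k ℕ.* a)) * f (p ℕ.^ (k ℕ.* b))))
    where

    import Data.Nat.Properties as ℕₚ
    open import Data.Nat.Divisibility using (m∣m*n; n∣m*n)
    open import Data.Nat.Primality using (prime⇒nonZero)
    open import Algebra.Properties.CommutativeSemiring.Exp commutativeSemiring using (^-distrib-*; ^-congˡ)
    open import Algebra.Properties.CommutativeSemigroup *-commutativeSemigroup using (interchange)
    import Algebra.Properties.CommutativeSemigroup ℕₚ.*-commutativeSemigroup as ℕ-Semigroup
    open import Relation.Binary.PropositionalEquality as ≡ using (_≡_)
    open import Relation.Binary.Reasoning.Setoid setoid
    open IsPreorder ∼-isPreorder using () renaming (≲-respˡ-≈ to ∼-respˡ-≈; ≲-respʳ-≈ to ∼-respʳ-≈)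
    open OrderedCommutativeRingProperties R using (x^n-nonNeg)

    Related : ℕ → ℕ → Set ℓ₂
    Related m n = (f (m ℕ.* n) ^ k) ∼ (f (m ℕ.^ k) * f (n ℕ.^ k))

    f-cong : ∀ {m n} → m ≡ n → f m ≈ f n
    f-cong ≡.refl = refl

    related-prime-power : ∀ p → Prime p → ∀ a b → Related (p ℕ.^ a) (p ℕ.^ b)
    related-prime-power p pp a b
      rewrite ≡.sym (ℕₚ.^-distribˡ-+-* p a b) | ℕₚ.^-*-assoc p a k | ℕₚ.^-*-assoc p b k
            | ℕₚ.*-comm a k | ℕₚ.*-comm b k
      = prime-condition p pp a b

    f-^-coprime : ∀ m n → .{{NonZero m}} → .{{NonZero n}} → Coprime m n →
      (f (m ℕ.^ k) * f (n ℕ.^ k)) ≈ f ((m ℕ.* n) ℕ.^ k)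
    f-^-coprime m n coprime = begin
      f (m ℕ.^ k) * f (n ℕ.^ k)   ≈⟨ f-mult (m ℕ.^ k) (n ℕ.^ k) (coprime-^ k k coprime) ⟨
      f (m ℕ.^ k ℕ.* n ℕ.^ k)     ≈⟨ f-cong (^-distribʳ-* m n k) ⟨
      f ((m ℕ.* n) ℕ.^ k)         ∎
      where
      instance
        _ = ℕₚ.m^n≢0 m k
        _ = ℕₚ.m^n≢0 n k

    related-coprime-* : ∀ m₁ n₁ m₂ n₂ →
      .{{NonZero m₁}} → .{{NonZero n₁}} → .{{NonZero m₂}} → .{{NonZero n₂}} →
      Coprime (m₁ ℕ.* n₁) (m₂ ℕ.* n₂) → Related m₁ n₁ → Related m₂ n₂ →
      Related (m₁ ℕ.* m₂) (n₁ ℕ.* n₂)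
    related-coprime-* m₁ n₁ m₂ n₂ coprime r₁ r₂ =
      ∼-respˡ-≈ lhs≈ (∼-respʳ-≈ rhs≈ (∼-*-nonNeg
        (x^n-nonNeg (f-nonNeg (m₁ ℕ.* n₁)) k) (0≤* (f-nonNeg (m₁ ℕ.^ k)) (f-nonNeg (n₁ ℕ.^ k)))
        (x^n-nonNeg (f-nonNeg (m₂ ℕ.* n₂)) k) (0≤* (f-nonNeg (m₂ ℕ.^ k)) (f-nonNeg (n₂ ℕ.^ k)))
        r₁ r₂))
      where
      instance
        _ = ℕₚ.m*n≢0 m₁ n₁
        _ = ℕₚ.m*n≢0 m₂ n₂
        _ = ℕₚ.m^n≢0 m₁ k
        _ = ℕₚ.m^n≢0 n₁ k
        _ = ℕₚ.m^n≢0 m₂ k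
        _ = ℕₚ.m^n≢0 n₂ k
      lhs≈ : ((f (m₁ ℕ.* n₁) ^ k) * (f (m₂ ℕ.* n₂) ^ k)) ≈ (f ((m₁ ℕ.* m₂) ℕ.* (n₁ ℕ.* n₂)) ^ k)
      lhs≈ = begin
        f (m₁ ℕ.* n₁) ^ k * f (m₂ ℕ.* n₂) ^ k     ≈⟨ ^-distrib-* _ _ k ⟨
        (f (m₁ ℕ.* n₁) * f (m₂ ℕ.* n₂)) ^ k       ≈⟨ ^-congˡ k (f-mult _ _ coprime) ⟨
        f ((m₁ ℕ.* n₁) ℕ.* (m₂ ℕ.* n₂)) ^ k       ≈⟨ ^-congˡ k (f-cong (ℕ-Semigroup.interchange m₁ n₁ m₂ n₂)) ⟩
        f ((m₁ ℕ.* m₂) ℕ.* (n₁ ℕ.* n₂)) ^ k       ∎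
      rhs≈ : ((f (m₁ ℕ.^ k) * f (n₁ ℕ.^ k)) * (f (m₂ ℕ.^ k) * f (n₂ ℕ.^ k)))
             ≈ (f ((m₁ ℕ.* m₂) ℕ.^ k) * f ((n₁ ℕ.* n₂) ℕ.^ k))
      rhs≈ = trans (interchange _ _ _ _) (*-cong
        (f-^-coprime m₁ m₂ (coprime-∣ (m∣m*n n₁) (m∣m*n n₂) coprime))
        (f-^-coprime n₁ n₂ (coprime-∣ (n∣m*n m₁) (n∣m*n m₂) coprime)))

    related-step : ∀ p a b m n → Prime p → p ∤ m → p ∤ n → Related m n →
      Related (p ℕ.^ a ℕ.* m) (p ℕ.^ b ℕ.* n)
    related-step p a b m n pp p∤m p∤n =
      related-coprime-* (p ℕ.^ a) (p ℕ.^ b) m n coprime (related-prime-power p pp a b)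
      where
      instance
        _ = prime⇒nonZero pp
        _ = ℕₚ.m^n≢0 p a
        _ = ℕₚ.m^n≢0 p b
        _ = ∤⇒nonZero p∤m
        _ = ∤⇒nonZero p∤n
      p⊥m*n : Coprime p (m ℕ.* n)
      p⊥m*n = coprime-*ʳ (prime∧∤⇒coprime pp p∤m) (prime∧∤⇒coprime pp p∤n)
      coprime : Coprime (p ℕ.^ a ℕ.* p ℕ.^ b) (m ℕ.* n)
      coprime = coprime-*ˡ (coprime-^ˡ a p⊥m*n) (coprime-^ˡ b p⊥m*n)

    -- The case m = n = 1 is the prime-power condition at p = 2, a = b = 0.
    related : ∀ m n → .{{NonZero m}} → .{{NonZero n}} → Related m n
    related = pairInduction Related (related-prime-power 2 prime[2] 0 0) related-step

theorem7 : ∀ {c ℓ₁ ℓ₂} (R : OrderedCommutativeRing c ℓ₁ ℓ₂) →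
    let open OrderedCommutativeRing R in
    (f : ℕ → Carrier) → Nonnegative R f → Multiplicative R f → f 1 ≈ 1# →
    (k : ℕ) → 2 ℕ.≤ k →
    (PrimeSubCondition R k f → SubMultiplicative R k f) ×
    (PrimeSuperCondition R k f → SuperMultiplicative R k f)
theorem7 R f f-nonNeg f-mult _ k _ =
    (λ sub m n → PrimePowerTransfer.related R _≤_ isPreorder
                   (λ _ 0≤y 0≤u _ → *-mono-≤-nonNeg 0≤y 0≤u) f f-nonNeg f-mult k sub m n)
  , (λ super m n → PrimePowerTransfer.related R (flip _≤_) (Flip.isPreorder isPreorder)
                   (λ 0≤x _ _ 0≤v → *-mono-≤-nonNeg 0≤x 0≤v) f f-nonNeg f-mult k super m n)
  where
  open OrderedCommutativeRing R
  open OrderedCommutativeRingProperties R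
  open IsTotalOrder isTotalOrder using (isPreorder)
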